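{- Let $m\ge 1$ and let $\Lambda_i$, $i=1,\dots,m$, be pairwise vertex-disjoint complete bipartite digraphs with nonempty colour classes $U_i$ and $W_i$ (so $uw$ and $wu$ are edges of $\Lambda_i$ for all $u\in U_i$, $w\in W_i$). Put $U=\bigcup_{i=1}^m U_i$, $W=\bigcup_{i=1}^m W_i$, and let $\Gamma$ be the digraph on $U\cup W$ with edge set $E=F\cup G$, where $F$ is the set of all edges of all $\Lambda_i$, and $G$ consists of all edges $uw$ with $u\in U_1$, $w\in W_i$, and all edges $wu$ with $w\in W_1$, $u\in U_i$, for $2\le i\le m$. Then $\Gamma$ is a 2-colored best match graph (2-cBMG) with colour classes $U$ and $W$.
   Context: Digraphs have no loops or multiple edges; $xy$ denotes the edge with tail $x$ and head $y$; $N(x)$, $N^-(x)$ are out- and in-neighbourhoods, $N(S)=\bigcup_{s\in S}N(s)$. A 2-cBMG is a bipartite digraph (two colour classes, every edge joining different classes), not necessarily connected, satisfying: N1: for any vertices $x,y$ with $x\notin N(y)$, $y\notin N(x)$, $N(x)\cap N(N(y))=N(y)\cap N(N(x))=\emptyset$; N2: $N(N(N(x)))\subseteq N(x)$ for all $x$; N3: for any vertices $x,y$ with $x\notin N(N(y))$, $y\notin N(N(x))$ and $N(x)\cap N(y)\neq\emptyset$, $N^-(x)=N^-(y)$ and $N(x)\subseteq N(y)$ or $N(y)\subseteq N(x)$; N4: every vertex has an out-neighbour. -}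

module Defs where

open import Data.Nat using (ℕ; _<_)
open import Data.Fin using (Fin; zero; suc)
open import Data.Bool using (Bool; true; false)
open import Data.Sum using (_⊎_; inj₁; inj₂)
open import Data.Product using (Σ; _×_; _,_; ∃-syntax)
open import Relation.Nullary using (¬_)
open import Relation.Binary.PropositionalEquality using (_≡_; _≢_)
open import Function.Bundles using (_⇔_)

-- A digraph on vertex type V is given by its edge relation E (E x y : "xy is an edge").
module _ {V : Set} (E : V → V → Set) where

  N² : V → V → Set
  N² x z = ∃[ w ] (E x w × E w z)

  N³ : V → V → Set
  N³ x z = ∃[ w ] (N² x w × E w z)

  -- bipartite with colour classes { x | col x ≡ true } and { x | col x ≡ false }
  -- (this also forbids loops)
  BipartiteWrt : (V → Bool) → Set
  BipartiteWrt col = ∀ x y → E x y → col x ≢ col y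

  AxN1 : Set
  AxN1 = ∀ x y → ¬ E y x → ¬ E x y →
           (∀ z → ¬ (E x z × N² y z)) × (∀ z → ¬ (E y z × N² x z))

  AxN2 : Set
  AxN2 = ∀ x z → N³ x z → E x z

  AxN3 : Set
  AxN3 = ∀ x y → ¬ N² y x → ¬ N² x y → (∃[ z ] (E x z × E y z)) →
           (∀ z → E z x ⇔ E z y) ×
           ((∀ z → E x z → E y z) ⊎ (∀ z → E y z → E x z))

  AxN4 : Set
  AxN4 = ∀ x → ∃[ y ] E x y

  record Is2cBMG (col : V → Bool) : Set where
    field
      bipartite : BipartiteWrt col
      n1 : AxN1
      n2 : AxN2
      n3 : AxN3
      n4 : AxN4

-- The construction of the proposition, with m = suc k.  Block i : Fin (suc k)
-- (zero is Λ₁) has colour classes U_i = Fin (p i) and W_i = Fin (q i).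
module Construction (k : ℕ) (p q : Fin (ℕ.suc k) → ℕ) where

  Vtx : Set
  Vtx = Σ (Fin (ℕ.suc k)) (λ i → Fin (p i) ⊎ Fin (q i))

  colour : Vtx → Bool
  colour (_ , inj₁ _) = true
  colour (_ , inj₂ _) = false

  data Edge : Vtx → Vtx → Set where
    fUW : ∀ i (u : Fin (p i)) (w : Fin (q i)) → Edge (i , inj₁ u) (i , inj₂ w)
    fWU : ∀ i (w : Fin (q i)) (u : Fin (p i)) → Edge (i , inj₂ w) (i , inj₁ u)
    gUW : ∀ (i : Fin k) (u : Fin (p zero)) (w : Fin (q (suc i))) →
            Edge (zero , inj₁ u) (suc i , inj₂ w)
    gWU : ∀ (i : Fin k) (w : Fin (q zero)) (u : Fin (p (suc i))) →
            Edge (zero , inj₂ w) (suc i , inj₁ u)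

-- An edge of Γ is exactly a pair of vertices of different colours lying in
-- blocks i, j with i = j or i = 1.  In this star order two blocks with a common
-- upper bound are comparable.  Hence a path of length three shortcuts to an
-- edge (N2), and two vertices of the same colour with a common out-neighbour
-- are joined by a path of length two through a vertex of the lower block (N3
-- holds vacuously); N1 is the same comparability argument.
module Submission where

open import Defs
open import Data.Nat using (ℕ; suc; _<_)
open import Data.Fin using (Fin; zero; suc; fromℕ<)
open import Data.Bool using (Bool)
open import Data.Bool.Properties using (¬-not)
open import Data.Sum using (_⊎_; inj₁; inj₂; [_,_])
open import Data.Product using (_×_; _,_; proj₁; proj₂; ∃-syntax)
open import Data.Empty using (⊥-elim)
open import Function.Bundles using (_⇔_; Equivalence; mk⇔)
open import Relation.Binary.PropositionalEquality
  using (_≡_; _≢_; refl; sym; trans; subst; ≢-sym)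

≢-same⇒≡ : ∀ {a b c : Bool} → a ≢ c → b ≢ c → a ≡ b
≢-same⇒≡ a≢c b≢c = trans (¬-not a≢c) (sym (¬-not b≢c))

≢-≢⇒≡ : ∀ {a b c : Bool} → a ≢ b → b ≢ c → a ≡ c
≢-≢⇒≡ a≢b b≢c = ≢-same⇒≡ a≢b (≢-sym b≢c)

module BlockOrdered
  {V B : Set} (E : V → V → Set) (colour : V → Bool) (block : V → B)
  (_▷_ : B → B → Set)
  (▷-trans : ∀ {a b c} → a ▷ b → b ▷ c → a ▷ c)
  (▷-comparable : ∀ {a b c} → a ▷ c → b ▷ c → a ▷ b ⊎ b ▷ a)
  (edge⇔ : ∀ x y → E x y ⇔ (colour x ≢ colour y × block x ▷ block y))
  (two-cycle : ∀ x → ∃[ y ] (E x y × E y x))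
  where

  edge-elim : ∀ {x y} → E x y → colour x ≢ colour y × block x ▷ block y
  edge-elim {x} {y} = Equivalence.to (edge⇔ x y)

  edge-intro : ∀ {x y} → colour x ≢ colour y → block x ▷ block y → E x y
  edge-intro {x} {y} c b = Equivalence.from (edge⇔ x y) (c , b)

  adjacent-if-meeting : ∀ {x y w z} → E x z → E y w → E w z → E x y ⊎ E y x
  adjacent-if-meeting {y = y} exz eyw ewz
    with edge-elim exz | edge-elim eyw | edge-elim ewz
  ... | x≢z , x▷z | y≢w , y▷w | w≢z , w▷z
    with subst (colour y ≢_) (sym (≢-same⇒≡ x≢z w≢z)) y≢w
       | ▷-comparable x▷z (▷-trans y▷w w▷z)
  ... | y≢x | inj₁ x▷y = inj₁ (edge-intro (≢-sym y≢x) x▷y)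
  ... | y≢x | inj₂ y▷x = inj₂ (edge-intro y≢x y▷x)

  N²-via-partner : ∀ {x y} → block x ▷ block y → colour x ≡ colour y → N² E x y
  N²-via-partner {x} x▷y x≡y with two-cycle x
  ... | m , exm , emx with edge-elim emx
  ... | m≢x , m▷x =
    m , exm , edge-intro (λ m≡y → m≢x (trans m≡y (sym x≡y))) (▷-trans m▷x x▷y)

  common-out⇒N² : ∀ {x y z} → E x z → E y z → N² E x y ⊎ N² E y x
  common-out⇒N² exz eyz with edge-elim exz | edge-elim eyz
  ... | x≢z , x▷z | y≢z , y▷z with ▷-comparable x▷z y▷z
  ... | inj₁ x▷y = inj₁ (N²-via-partner x▷y (≢-same⇒≡ x≢z y≢z))
  ... | inj₂ y▷x = inj₂ (N²-via-partner y▷x (≢-same⇒≡ y≢z x≢z))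

  path³⇒edge : ∀ {x a b z} → E x a → E a b → E b z → E x z
  path³⇒edge exa eab ebz with edge-elim exa | edge-elim eab | edge-elim ebz
  ... | x≢a , x▷a | a≢b , a▷b | b≢z , b▷z =
    edge-intro (λ x≡z → b≢z (trans (sym (≢-≢⇒≡ x≢a a≢b)) x≡z))
               (▷-trans x▷a (▷-trans a▷b b▷z))

  is2cBMG : Is2cBMG E colour
  is2cBMG = record
    { bipartite = λ _ _ exy → proj₁ (edge-elim exy)
    ; n1 = λ _ _ ¬eyx ¬exy →
        (λ { _ (exz , _ , eyw , ewz) → [ ¬exy , ¬eyx ] (adjacent-if-meeting exz eyw ewz) })
      , (λ { _ (eyz , _ , exw , ewz) → [ ¬eyx , ¬exy ] (adjacent-if-meeting eyz exw ewz) })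
    ; n2 = λ { _ _ (_ , (_ , exa , eab) , ebz) → path³⇒edge exa eab ebz }
    ; n3 = λ { _ _ ¬N²yx ¬N²xy (_ , exz , eyz) →
        ⊥-elim ([ ¬N²xy , ¬N²yx ] (common-out⇒N² exz eyz)) }
    ; n4 = λ x → proj₁ (two-cycle x) , proj₁ (proj₂ (two-cycle x))
    }

StarOrder : {B : Set} → B → B → B → Set
StarOrder r a b = a ≡ b ⊎ a ≡ r

module _ {B : Set} {r : B} where

  star-trans : ∀ {a b c} → StarOrder r a b → StarOrder r b c → StarOrder r a c
  star-trans (inj₁ refl) b▷c = b▷c
  star-trans (inj₂ a≡r)  _   = inj₂ a≡r

  star-comparable : ∀ {a b c} → StarOrder r a c → StarOrder r b c →
                    StarOrder r a b ⊎ StarOrder r b a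
  star-comparable (inj₂ a≡r)  _           = inj₁ (inj₂ a≡r)
  star-comparable (inj₁ _)    (inj₂ b≡r)  = inj₂ (inj₂ b≡r)
  star-comparable (inj₁ refl) (inj₁ refl) = inj₁ (inj₁ refl)

module _ (k : ℕ) (p q : Fin (suc k) → ℕ) where
  open Construction k p q

  BlockOrder : Vtx → Vtx → Set
  BlockOrder x y = StarOrder zero (proj₁ x) (proj₁ y)

  edge-alternates : ∀ {x y} → Edge x y → colour x ≢ colour y × BlockOrder x y
  edge-alternates (fUW _ _ _) = (λ ()) , inj₁ refl
  edge-alternates (fWU _ _ _) = (λ ()) , inj₁ refl
  edge-alternates (gUW _ _ _) = (λ ()) , inj₂ refl
  edge-alternates (gWU _ _ _) = (λ ()) , inj₂ refl

  alternating⇒edge : ∀ {x y} → colour x ≢ colour y → BlockOrder x y → Edge x y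
  alternating⇒edge {_ , inj₁ _} {_ , inj₁ _} c≢c _ = ⊥-elim (c≢c refl)
  alternating⇒edge {_ , inj₂ _} {_ , inj₂ _} c≢c _ = ⊥-elim (c≢c refl)
  alternating⇒edge {i , inj₁ u} {_ , inj₂ w} _ (inj₁ refl) = fUW i u w
  alternating⇒edge {i , inj₂ w} {_ , inj₁ u} _ (inj₁ refl) = fWU i w u
  alternating⇒edge {_ , inj₁ u} {zero , inj₂ w} _ (inj₂ refl) = fUW zero u w
  alternating⇒edge {_ , inj₂ w} {zero , inj₁ u} _ (inj₂ refl) = fWU zero w u
  alternating⇒edge {_ , inj₁ u} {suc j , inj₂ w} _ (inj₂ refl) = gUW j u w
  alternating⇒edge {_ , inj₂ w} {suc j , inj₁ u} _ (inj₂ refl) = gWU j w u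

  edge⇔alternating : ∀ x y → Edge x y ⇔ (colour x ≢ colour y × BlockOrder x y)
  edge⇔alternating x y =
    mk⇔ edge-alternates (λ (c≢c , x▷y) → alternating⇒edge c≢c x▷y)

  two-cycle : (∀ i → 0 < p i) → (∀ i → 0 < q i) → ∀ x → ∃[ y ] (Edge x y × Edge y x)
  two-cycle _  qp (i , inj₁ u) = (i , inj₂ (fromℕ< (qp i))) , fUW i u _ , fWU i _ u
  two-cycle pp _  (i , inj₂ w) = (i , inj₁ (fromℕ< (pp i))) , fWU i w _ , fUW i _ w

proposition9 : (k : ℕ) (p q : Fin (suc k) → ℕ) →
    (∀ i → 0 < p i) → (∀ i → 0 < q i) →
    Is2cBMG (Construction.Edge k p q) (Construction.colour k p q)
proposition9 k p q pp qp =
  BlockOrdered.is2cBMG (Construction.Edge k p q) (Construction.colour k p q) proj₁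
    (StarOrder zero) star-trans star-comparable
    (edge⇔alternating k p q) (two-cycle k p q pp qp)
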